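{- For every prime power $q\ge 2$ and all integers $t\ge 2$ and $k\ge 1$, \[ R_q(t;k) > (t-1)k. \]
   Context: For a prime power $q$ and integers $t\ge 1$, $k\ge 1$, the vector space Ramsey number $R_q(t;k)$ is the smallest integer $n$ such that for every coloring of the $1$-dimensional linear subspaces of $\mathbb{F}_q^n$ with $k$ colors there exists a $t$-dimensional linear subspace $U\le\mathbb{F}_q^n$ all of whose $1$-dimensional subspaces receive the same color. -}

module Defs where

open import Level using (0ℓ)
open import Algebra.Bundles using (CommutativeRing)
open import Data.Nat using (ℕ; zero; suc; _≤_; _^_)
open import Data.Nat.Primality using (Prime)
open import Data.Fin using (Fin)
open import Data.Product using (Σ; ∃; _×_; _,_)
open import Relation.Binary.PropositionalEquality using (_≡_)
open import Relation.Nullary using (¬_)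

IsPrimePower : ℕ → Set
IsPrimePower q = Σ ℕ λ p → Σ ℕ λ e → Prime p × 1 ≤ e × q ≡ p ^ e

module _ (F : CommutativeRing 0ℓ 0ℓ) where
  open CommutativeRing F renaming (Carrier to K)

  IsField : Set
  IsField = (¬ (0# ≈ 1#)) × (∀ x → ¬ (x ≈ 0#) → Σ K λ y → (x * y) ≈ 1#)

  HasCard : ℕ → Set
  HasCard q = Σ (Fin q → K) λ e →
                (∀ i j → e i ≈ e j → i ≡ j) × (∀ x → Σ (Fin q) λ i → e i ≈ x)

  Vect : ℕ → Set
  Vect n = Fin n → K

  _≋_ : ∀ {n} → Vect n → Vect n → Set
  v ≋ w = ∀ i → v i ≈ w i

  IsZeroVec : ∀ {n} → Vect n → Set
  IsZeroVec v = ∀ i → v i ≈ 0#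

  _•_ : ∀ {n} → K → Vect n → Vect n
  (c • v) i = c * v i

  sumK : ∀ t → (Fin t → K) → K
  sumK zero    f = 0#
  sumK (suc t) f = f Fin.zero + sumK t (λ i → f (Fin.suc i))

  lincomb : ∀ {t n} → (Fin t → K) → (Fin t → Vect n) → Vect n
  lincomb {t} a u j = sumK t (λ i → a i * u i j)

  LinIndep : ∀ {t n} → (Fin t → Vect n) → Set
  LinIndep {t} u = ∀ a → IsZeroVec (lincomb a u) → ∀ i → a i ≈ 0#

  -- A k-coloring of the 1-dimensional subspaces of F^n, represented as a
  -- coloring of vectors which is constant on each line (nonzero scalar
  -- multiples of a nonzero vector); the value at the zero vector is irrelevant.
  record LineColoring (n k : ℕ) : Set where
    field
      col       : Vect n → Fin k
      col-cong  : ∀ {v w} → v ≋ w → col v ≡ col w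
      col-scale : ∀ c v → ¬ (c ≈ 0#) → ¬ IsZeroVec v → col (c • v) ≡ col v

  -- the t-dimensional subspace spanned by the independent vectors u is
  -- monochromatic: all its nonzero vectors (i.e. all its 1-dim subspaces)
  -- receive the same color
  Monochromatic : ∀ {t n k} → LineColoring n k → (Fin t → Vect n) → Set
  Monochromatic {t} {n} {k} χ u =
    Σ (Fin k) λ colour → ∀ a → ¬ IsZeroVec (lincomb a u) →
      LineColoring.col χ (lincomb a u) ≡ colour

  -- n has the Ramsey property for (t;k): every k-coloring of the
  -- 1-dim subspaces of F^n has a monochromatic t-dim subspace.
  -- R_q(t;k) is the least n with this property.
  RamseyProperty : ℕ → ℕ → ℕ → Set
  RamseyProperty t k n =
    (χ : LineColoring n k) →
      Σ (Fin t → Vect n) λ u → LinIndep u × Monochromatic χ u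

{-# OPTIONS --safe #-}
-- Cut the coordinate positions of F^n into k consecutive blocks of t − 1 positions and
-- colour a line by the block holding the first nonzero coordinate of its vectors. If a
-- t-dimensional subspace were monochromatic of colour c, restricting t independent vectors
-- spanning it to the t − 1 coordinates of block c would give t vectors in F^(t−1), hence a
-- nontrivial relation; the same combination of the unrestricted vectors is a nonzero vector
-- of the subspace vanishing on block c, so its first nonzero coordinate is outside block c.
module Submission where

open import Defs
open import Level using (0ℓ)
open import Algebra.Bundles using (CommutativeRing)
import Algebra.Properties.Semiring.Sum as Sum
import Data.Nat as ℕ
open ℕ using (ℕ; zero; suc; _≤_; _<_; _/_; NonZero; s≤s; z≤n)
open import Data.Nat.Properties using (n<1+n; m<n⇒m<1+n; <-≤-trans)
open import Data.Fin as Fin using (Fin; toℕ; fromℕ<; punchIn)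
open import Data.Fin.Properties using (any?)
open import Data.Vec.Functional using (insertAt; removeAt; tail)
open import Data.Vec.Functional.Properties using (insertAt-lookup; insertAt-punchIn)
open import Data.Product using (∃; ∄; _×_; _,_; proj₁; proj₂)
open import Data.Sum using (_⊎_; inj₁; inj₂)
open import Function using (_∘_; _⇔_; mk⇔; Equivalence)
open import Relation.Binary.Definitions using (Decidable)
open import Relation.Binary.PropositionalEquality as ≡ using (_≡_; _≢_)
open import Relation.Nullary using (¬_; yes; no; ¬?; contradiction)
open import Relation.Nullary.Decidable using (map′; decidable-stable)

module _ where
  open import Data.Nat using (_+_; _*_; _%_)
  open import Data.Nat.Properties using (m<1+n⇒m≤n; *-comm; +-comm)
  open import Data.Nat.DivMod using (m≡m%n+[m/n]*n; m%n<n; m<n*o⇒m/o<n)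
  open import Data.Fin.Properties using (toℕ-fromℕ<; toℕ-combine)
  open ≡.≡-Reasoning

  clamp : ∀ k → ℕ → Fin (suc k)
  clamp zero    _       = Fin.zero
  clamp (suc k) zero    = Fin.zero
  clamp (suc k) (suc m) = Fin.suc (clamp k m)

  toℕ-clamp : ∀ k {m} → m ≤ k → toℕ (clamp k m) ≡ m
  toℕ-clamp zero    z≤n       = ≡.refl
  toℕ-clamp (suc k) z≤n       = ≡.refl
  toℕ-clamp (suc k) (s≤s m≤k) = ≡.cong suc (toℕ-clamp k m≤k)

  -- Saturation matters only for the zero vector, whose leading position is n.
  blockOf : ∀ s k .{{_ : NonZero s}} → ℕ → Fin (suc k)
  blockOf s k m = clamp k (m / s)

  blockOf-spec : ∀ {s k m} .{{_ : NonZero s}} {c : Fin (suc k)} →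
                 m < s * suc k → blockOf s k m ≡ c → ∃ λ (r : Fin s) → m ≡ toℕ (Fin.combine c r)
  blockOf-spec {s} {k} {m} {c} m<sk block≡c = r , (begin
    m                  ≡⟨ m≡m%n+[m/n]*n m s ⟩
    m % s + m / s * s  ≡⟨ +-comm (m % s) _ ⟩
    m / s * s + m % s  ≡⟨ ≡.cong₂ _+_ (*-comm (m / s) s) (≡.sym (toℕ-fromℕ< (m%n<n m s))) ⟩
    s * (m / s) + toℕ r ≡⟨ ≡.cong (λ b → s * b + toℕ r) m/s≡c ⟩
    s * toℕ c + toℕ r  ≡⟨ toℕ-combine c r ⟨
    toℕ (Fin.combine c r) ∎)
    where
    r = fromℕ< (m%n<n m s)
    m/s≤k : m / s ≤ k
    m/s≤k = m<1+n⇒m≤n (m<n*o⇒m/o<n (≡.subst (m <_) (*-comm s (suc k)) m<sk))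
    m/s≡c : m / s ≡ toℕ c
    m/s≡c = ≡.trans (≡.sym (toℕ-clamp k m/s≤k)) (≡.cong toℕ block≡c)

module _ (F : CommutativeRing 0ℓ 0ℓ) where
  open CommutativeRing F

  hasCard⇒decidable : ∀ {q} → HasCard F q → Decidable _≈_
  hasCard⇒decidable (e , e-injective , e-surjective) x y with e-surjective x | e-surjective y
  ... | i , eᵢ≈x | j , eⱼ≈y =
    map′ (λ i≡j → trans (sym eᵢ≈x) (trans (reflexive (≡.cong e i≡j)) eⱼ≈y))
         (λ x≈y → e-injective i j (trans eᵢ≈x (trans x≈y (sym eⱼ≈y))))
         (i Fin.≟ j)

module LinearAlgebra (F : CommutativeRing 0ℓ 0ℓ) (isField : IsField F)
                     (_≟_ : Decidable (CommutativeRing._≈_ F)) where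
  open CommutativeRing F renaming (Carrier to K) hiding (zero)
  open Sum semiring using (sum; sum-cong-≋; sum-cong-≗; sum-replicate-zero; sum-remove; ∑-distrib-+; *-distribʳ-sum)
  open import Algebra.Properties.Ring ring using (-‿distribˡ-*)
  open import Relation.Binary.Reasoning.Setoid setoid

  sumK≡sum : ∀ t (f : Fin t → K) → sumK F t f ≡ sum f
  sumK≡sum zero    f = ≡.refl
  sumK≡sum (suc t) f = ≡.cong (f Fin.zero +_) (sumK≡sum t (f ∘ Fin.suc))

  lincomb≡sum : ∀ {t n} (a : Fin t → K) (u : Fin t → Vect F n) j →
                lincomb F a u j ≡ sum (λ i → a i * u i j)
  lincomb≡sum {t} a u j = sumK≡sum t (λ i → a i * u i j)

  lincomb-insertAt : ∀ {t n} (b : Fin t → K) p c (u : Fin (suc t) → Vect F n) j →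
                     lincomb F (insertAt b p c) u j ≈ c * u p j + lincomb F b (removeAt u p) j
  lincomb-insertAt b p c u j = begin
    lincomb F (insertAt b p c) u j
      ≡⟨ lincomb≡sum (insertAt b p c) u j ⟩
    sum (λ i → insertAt b p c i * u i j)
      ≈⟨ sum-remove {i = p} (λ i → insertAt b p c i * u i j) ⟩
    insertAt b p c p * u p j + sum (λ i → insertAt b p c (punchIn p i) * u (punchIn p i) j)
      ≡⟨ ≡.cong₂ _+_ (≡.cong (_* u p j) (insertAt-lookup b p c))
                     (sum-cong-≗ (λ i → ≡.cong (_* u (punchIn p i) j) (insertAt-punchIn b p c i))) ⟩
    c * u p j + sum (λ i → b i * removeAt u p i j)
      ≡⟨ ≡.cong (c * u p j +_) (≡.sym (lincomb≡sum b (removeAt u p) j)) ⟩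
    c * u p j + lincomb F b (removeAt u p) j ∎

  lincomb-shift : ∀ {t n} (b d : Fin t → K) (v : Fin t → Vect F n) (x : Vect F n) j →
                  lincomb F b (λ i j → v i j + d i * x j) j ≈ lincomb F b v j + sum (λ i → b i * d i) * x j
  lincomb-shift b d v x j = begin
    lincomb F b (λ i j → v i j + d i * x j) j
      ≡⟨ lincomb≡sum b (λ i j → v i j + d i * x j) j ⟩
    sum (λ i → b i * (v i j + d i * x j))
      ≈⟨ sum-cong-≋ (λ i → trans (distribˡ (b i) _ _) (+-congˡ (sym (*-assoc (b i) (d i) (x j))))) ⟩
    sum (λ i → b i * v i j + b i * d i * x j)
      ≈⟨ ∑-distrib-+ (λ i → b i * v i j) (λ i → b i * d i * x j) ⟩
    sum (λ i → b i * v i j) + sum (λ i → b i * d i * x j)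
      ≈⟨ +-cong (reflexive (≡.sym (lincomb≡sum b v j))) (sym (*-distribʳ-sum (x j) (λ i → b i * d i))) ⟩
    lincomb F b v j + sum (λ i → b i * d i) * x j ∎

  sum≈0 : ∀ {t} {f : Fin t → K} → (∀ i → f i ≈ 0#) → sum f ≈ 0#
  sum≈0 {t} fᵢ≈0 = trans (sum-cong-≋ fᵢ≈0) (sum-replicate-zero t)

  Dependent : ∀ {t n} → (Fin t → Vect F n) → Set
  Dependent {t} u = ∃ λ (a : Fin t → K) → (∃ λ i → ¬ a i ≈ 0#) × IsZeroVec F (lincomb F a u)

  dependent-tail : ∀ {t n} (u : Fin t → Vect F (suc n)) →
                   (∀ i → u i Fin.zero ≈ 0#) → Dependent (tail ∘ u) → Dependent u
  dependent-tail u uᵢ₀≈0 (a , nontrivial , a-kills) = a , nontrivial , λ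
    { Fin.zero    → trans (reflexive (lincomb≡sum a u Fin.zero))
                            (sum≈0 (λ i → trans (*-congˡ (uᵢ₀≈0 i)) (zeroʳ (a i))))
    ; (Fin.suc j) → a-kills j
    }

  -- Adding multiples of u p to the other vectors does not change the span.
  dependent-removeAt : ∀ {t n} (u : Fin (suc t) → Vect F n) p (d : Fin t → K) →
                       Dependent (λ i j → removeAt u p i j + d i * u p j) → Dependent u
  dependent-removeAt u p d (b , (i₀ , bᵢ₀≉0) , b-kills) = a , (punchIn p i₀ , aᵢ₀≉0) , a-kills
    where
    c = sum (λ i → b i * d i)
    a = insertAt b p c
    aᵢ₀≉0 : ¬ a (punchIn p i₀) ≈ 0#
    aᵢ₀≉0 = ≡.subst (λ x → ¬ x ≈ 0#) (≡.sym (insertAt-punchIn b p c i₀)) bᵢ₀≉0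
    a-kills : IsZeroVec F (lincomb F a u)
    a-kills j = begin
      lincomb F a u j                             ≈⟨ lincomb-insertAt b p c u j ⟩
      c * u p j + lincomb F b (removeAt u p) j    ≈⟨ +-comm _ _ ⟩
      lincomb F b (removeAt u p) j + c * u p j    ≈⟨ lincomb-shift b d (removeAt u p) (u p) j ⟨
      lincomb F b (λ i j → removeAt u p i j + d i * u p j) j ≈⟨ b-kills j ⟩
      0#                                          ∎

  cancel-pivot : ∀ {x y} a → x * y ≈ 1# → a + - (a * y) * x ≈ 0#
  cancel-pivot {x} {y} a xy≈1 = begin
    a + - (a * y) * x   ≈⟨ +-congˡ (sym (-‿distribˡ-* (a * y) x)) ⟩
    a + - (a * y * x)   ≈⟨ +-congˡ (-‿cong (*-assoc a y x)) ⟩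
    a + - (a * (y * x)) ≈⟨ +-congˡ (-‿cong (*-congˡ (trans (*-comm y x) xy≈1))) ⟩
    a + - (a * 1#)      ≈⟨ +-congˡ (-‿cong (*-identityʳ a)) ⟩
    a + - a             ≈⟨ -‿inverseʳ a ⟩
    0#                  ∎

  n<t⇒dependent : ∀ {n t} → n < t → (u : Fin t → Vect F n) → Dependent u
  n<t⇒dependent {zero}  {suc t} _ u = (λ _ → 1#) , (Fin.zero , proj₁ isField ∘ sym) , λ ()
  n<t⇒dependent {suc n} {suc t} (s≤s n<t) u with any? (λ p → ¬? (u p Fin.zero ≟ 0#))
  ... | no noPivot =
    dependent-tail u (λ p → decidable-stable (u p Fin.zero ≟ 0#) (λ uₚ₀≉0 → noPivot (p , uₚ₀≉0)))
                     (n<t⇒dependent (m<n⇒m<1+n n<t) (tail ∘ u))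
  ... | yes (p , uₚ₀≉0) =
    dependent-removeAt u p d (dependent-tail w w-head (n<t⇒dependent n<t (tail ∘ w)))
    where
    inverse = proj₂ isField (u p Fin.zero) uₚ₀≉0
    d : Fin t → K
    d i = - (removeAt u p i Fin.zero * proj₁ inverse)
    w : Fin t → Vect F (suc n)
    w i j = removeAt u p i j + d i * u p j
    w-head : ∀ i → w i Fin.zero ≈ 0#
    w-head i = cancel-pivot (removeAt u p i Fin.zero) (proj₂ inverse)

  coord : ∀ {n} → Vect F n → ℕ → K
  coord {zero}  v m       = 0#
  coord {suc n} v zero    = v Fin.zero
  coord {suc n} v (suc m) = coord (tail v) m

  coord-lincomb : ∀ {t n} (a : Fin t → K) (u : Fin t → Vect F n) m →
                  coord (lincomb F a u) m ≈ sum (λ i → a i * coord (u i) m)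
  coord-lincomb {n = zero}  a u m       = sym (sum≈0 (λ i → zeroʳ (a i)))
  coord-lincomb {n = suc n} a u zero    = reflexive (lincomb≡sum a u Fin.zero)
  coord-lincomb {n = suc n} a u (suc m) = coord-lincomb a (tail ∘ u) m

  leading : ∀ {n} → Vect F n → ℕ
  leading {zero}  v = zero
  leading {suc n} v with v Fin.zero ≟ 0#
  ... | yes _ = suc (leading (tail v))
  ... | no  _ = zero

  leading-spec : ∀ {n} (v : Vect F n) → (leading v < n × ¬ coord v (leading v) ≈ 0#) ⊎ IsZeroVec F v
  leading-spec {zero}  v = inj₂ (λ ())
  leading-spec {suc n} v with v Fin.zero ≟ 0#
  ... | no v₀≉0 = inj₁ (s≤s z≤n , v₀≉0)
  ... | yes v₀≈0 with leading-spec (tail v)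
  ...   | inj₁ (m<n , vₘ≉0) = inj₁ (s≤s m<n , vₘ≉0)
  ...   | inj₂ tail≈0       = inj₂ λ { Fin.zero → v₀≈0 ; (Fin.suc i) → tail≈0 i }

  SameZeros : ∀ {n} → Vect F n → Vect F n → Set
  SameZeros v w = ∀ i → v i ≈ 0# ⇔ w i ≈ 0#

  leading-sameZeros : ∀ {n} {v w : Vect F n} → SameZeros v w → leading v ≡ leading w
  leading-sameZeros {zero}          _ = ≡.refl
  leading-sameZeros {suc n} {v} {w} v~w with v Fin.zero ≟ 0# | w Fin.zero ≟ 0#
  ... | yes _    | yes _    = ≡.cong suc (leading-sameZeros (v~w ∘ Fin.suc))
  ... | no  _    | no  _    = ≡.refl
  ... | yes v₀≈0 | no  w₀≉0 = contradiction (Equivalence.to (v~w Fin.zero) v₀≈0) w₀≉0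
  ... | no  v₀≉0 | yes w₀≈0 = contradiction (Equivalence.from (v~w Fin.zero) w₀≈0) v₀≉0

  ≋⇒sameZeros : ∀ {n} {v w : Vect F n} → _≋_ F v w → SameZeros v w
  ≋⇒sameZeros v≋w i = mk⇔ (trans (sym (v≋w i))) (trans (v≋w i))

  c*x≈0⇒x≈0 : ∀ {c x} → ¬ c ≈ 0# → c * x ≈ 0# → x ≈ 0#
  c*x≈0⇒x≈0 {c} {x} c≉0 cx≈0 = begin
    x             ≈⟨ *-identityˡ x ⟨
    1# * x        ≈⟨ *-congʳ (trans (*-comm c⁻¹ c) cc⁻¹≈1) ⟨
    c⁻¹ * c * x   ≈⟨ *-assoc c⁻¹ c x ⟩
    c⁻¹ * (c * x) ≈⟨ *-congˡ cx≈0 ⟩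
    c⁻¹ * 0#      ≈⟨ zeroʳ c⁻¹ ⟩
    0#            ∎
    where
    c⁻¹ = proj₁ (proj₂ isField c c≉0)
    cc⁻¹≈1 = proj₂ (proj₂ isField c c≉0)

  •-sameZeros : ∀ {n c} (v : Vect F n) → ¬ c ≈ 0# → SameZeros (_•_ F c v) v
  •-sameZeros {c = c} v c≉0 i = mk⇔ (c*x≈0⇒x≈0 c≉0) (λ vᵢ≈0 → trans (*-congˡ vᵢ≈0) (zeroʳ c))

  leadingBlockColouring : ∀ {n} s k .{{_ : NonZero s}} → LineColoring F n (suc k)
  leadingBlockColouring s k = record
    { col       = blockOf s k ∘ leading
    ; col-cong  = ≡.cong (blockOf s k) ∘ leading-sameZeros ∘ ≋⇒sameZeros
    ; col-scale = λ c v c≉0 _ → ≡.cong (blockOf s k) (leading-sameZeros (•-sameZeros v c≉0))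
    }

  blockCoords : ∀ {n k} s → Fin k → Vect F n → Vect F s
  blockCoords s c v r = coord v (toℕ (Fin.combine c r))

  blockCoords-lincomb : ∀ {t n k s} (c : Fin k) (a : Fin t → K) (u : Fin t → Vect F n) →
                        _≋_ F (blockCoords s c (lincomb F a u)) (lincomb F a (blockCoords s c ∘ u))
  blockCoords-lincomb c a u r = begin
    coord (lincomb F a u) (toℕ (Fin.combine c r))          ≈⟨ coord-lincomb a u _ ⟩
    sum (λ i → a i * coord (u i) (toℕ (Fin.combine c r))) ≡⟨ lincomb≡sum a (blockCoords _ c ∘ u) r ⟨
    lincomb F a (blockCoords _ c ∘ u) r                    ∎

  vanishingBlock⇒blockOf-leading≢ : ∀ {n s k} .{{_ : NonZero s}} → n ≤ s ℕ.* suc k →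
                                    (v : Vect F n) → ¬ IsZeroVec F v → (c : Fin (suc k)) →
                                    IsZeroVec F (blockCoords s c v) → blockOf s k (leading v) ≢ c
  vanishingBlock⇒blockOf-leading≢ n≤sk v v≉0 c block≈0 leading∈c with leading-spec v
  ... | inj₂ v≈0 = v≉0 v≈0
  ... | inj₁ (m<n , vₘ≉0) with blockOf-spec (<-≤-trans m<n n≤sk) leading∈c
  ...   | r , m≡cr = vₘ≉0 (≡.subst (λ m → coord v m ≈ 0#) (≡.sym m≡cr) (block≈0 r))

  leadingBlockColouring-noMonochromatic :
    ∀ {n s k} .{{_ : NonZero s}} → n ≤ s ℕ.* suc k →
    ∄ λ (u : Fin (suc s) → Vect F n) → LinIndep F u × Monochromatic F (leadingBlockColouring s k) u
  leadingBlockColouring-noMonochromatic {s = s} n≤sk (u , indep , c , mono) =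
    refute (n<t⇒dependent (n<1+n s) (blockCoords s c ∘ u))
    where
    refute : ¬ Dependent (blockCoords s c ∘ u)
    refute (a , (i₀ , aᵢ₀≉0) , a-kills-block) =
      vanishingBlock⇒blockOf-leading≢ n≤sk v v≉0 c block≈0 (mono a v≉0)
      where
      v = lincomb F a u
      v≉0 : ¬ IsZeroVec F v
      v≉0 v≈0 = aᵢ₀≉0 (indep a v≈0 i₀)
      block≈0 : IsZeroVec F (blockCoords s c v)
      block≈0 r = trans (blockCoords-lincomb c a u r) (a-kills-block r)

open import Data.Nat using (_*_; _∸_)

theorem1p5 : (q : ℕ) → IsPrimePower q →
    (F : CommutativeRing 0ℓ 0ℓ) → IsField F → HasCard F q →
    (t k : ℕ) → 2 ≤ t → 1 ≤ k →
    (n : ℕ) → n ≤ (t ∸ 1) * k → ¬ RamseyProperty F t k n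
theorem1p5 _ _ _ _       _    (suc zero)    _       (s≤s ()) _ _ _ _
theorem1p5 _ _ F isField card (suc (suc s)) (suc k) _ _ _ n≤sk ramsey =
  leadingBlockColouring-noMonochromatic n≤sk (ramsey (leadingBlockColouring (suc s) k))
  where open LinearAlgebra F isField (hasCard⇒decidable F card)
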